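{- The system $\mathbf{Mp}$ is contained in each of the systems $\mathbf{Pp}$, $\mathbf{Np}$ and $\mathbf{GS1p}$.
   Context: Formulas are built from literals (propositional variables $P$ and their complements $\bar P$) using $\wedge$ and $\vee$. Negation satisfies $\neg P=\bar P$ and is extended by De Morgan's laws. A sequent is a nonempty finite multiset of formulas. A comma denotes multiset union, and $\Gamma,\Delta,\Sigma$ denote possibly empty multisets. Rules: - Axiom: infer $P,\neg P$ from no premises. - $(\&)$: from $\Gamma,A$ and $\Gamma,B$ infer $\Gamma,A\wedge B$. - $(\otimes)$: from $\Delta,A$ and $\Sigma,B$ infer $\Delta,\Sigma,A\wedge B$. - $(\wedge)$: from $\Gamma,\Delta,A$ and $\Gamma,\Sigma,B$ infer $\Gamma,\Delta,\Sigma,A\wedge B$. - $(\oplus)$: consists of both $(\oplus_1)$ and $(\oplus_2)$, where $(\oplus_i)$ infers $\Gamma,A_1\vee A_2$ from $\Gamma,A_i$. - $(\mathrm{par})$: from $\Gamma,A,B$ infer $\Gamma,A\vee B$. - $(\mathsf W)$: from $\Gamma$ infer $\Gamma,A$. - $(\mathsf C)$: from $\Gamma,A,A$ infer $\Gamma,A$. The named systems are: - $\mathbf{Mp}$ = axiom + $(\wedge),(\oplus),(\mathrm{par})$; - $\mathbf{Pp}$ = axiom + $(\otimes),(\oplus),(\mathsf C)$; - $\mathbf{Np}$ = axiom + $(\&),(\mathrm{par}),(\mathsf W)$; - $\mathbf{GS1p}$ = axiom + $(\&),(\oplus),(\mathsf W),(\mathsf C)$. A rule is derivable in $S$ if, for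 every instance of it, the conclusion can be derived in $S$ from its premises used as extra leaves. $S$ contains $T$ if every rule of $T$ is derivable in $S$. -}

module Defs where

open import Data.Nat using (ℕ)
open import Data.List using (List; []; _∷_; [_]; _++_)
open import Data.List.Relation.Unary.All using (All)
open import Data.List.Membership.Propositional using (_∈_)
open import Data.List.Relation.Binary.Permutation.Propositional using (_↭_)
open import Data.Sum using (_⊎_)
open import Data.Product using (_×_)

data Literal : Set where
  pos : ℕ → Literal
  neg : ℕ → Literal

data Formula : Set where
  lit  : Literal → Formula
  _∧_  : Formula → Formula → Formula
  _∨_  : Formula → Formula → Formula

¬_ : Formula → Formula
¬ lit (pos P) = lit (neg P)
¬ lit (neg P) = lit (pos P)
¬ (A ∧ B) = (¬ A) ∨ (¬ B)
¬ (A ∨ B) = (¬ A) ∧ (¬ B)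

-- A sequent is a finite multiset of formulas: a list, considered up to
-- permutation (derivations are closed under _↭_ below).
Seq : Set
Seq = List Formula

-- A rule (scheme) is a predicate on instances: list of premises, conclusion.
Rule : Set₁
Rule = List Seq → Seq → Set

_∪_ : Rule → Rule → Rule
(R ∪ S) ps c = R ps c ⊎ S ps c
infixr 4 _∪_

data Ax : Rule where
  ax : ∀ P → Ax [] (lit (pos P) ∷ ¬ lit (pos P) ∷ [])

data With : Rule where
  with' : ∀ Γ A B → With ((Γ ++ [ A ]) ∷ (Γ ++ [ B ]) ∷ []) (Γ ++ [ A ∧ B ])

data Tensor : Rule where
  tensor : ∀ Δ Σ A B → Tensor ((Δ ++ [ A ]) ∷ (Σ ++ [ B ]) ∷ []) (Δ ++ Σ ++ [ A ∧ B ])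

data Mix : Rule where
  mix : ∀ Γ Δ Σ A B →
    Mix ((Γ ++ Δ ++ [ A ]) ∷ (Γ ++ Σ ++ [ B ]) ∷ []) (Γ ++ Δ ++ Σ ++ [ A ∧ B ])

data Oplus : Rule where
  oplus₁ : ∀ Γ A₁ A₂ → Oplus ((Γ ++ [ A₁ ]) ∷ []) (Γ ++ [ A₁ ∨ A₂ ])
  oplus₂ : ∀ Γ A₁ A₂ → Oplus ((Γ ++ [ A₂ ]) ∷ []) (Γ ++ [ A₁ ∨ A₂ ])

data Par : Rule where
  par : ∀ Γ A B → Par ((Γ ++ A ∷ B ∷ []) ∷ []) (Γ ++ [ A ∨ B ])

-- (W): Γ ⊢ Γ,A   (Γ nonempty, as sequents are nonempty: Γ = B ∷ Γ')
data Weak : Rule where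
  weak : ∀ B Γ A → Weak ((B ∷ Γ) ∷ []) ((B ∷ Γ) ++ [ A ])

data Contr : Rule where
  contr : ∀ Γ A → Contr ((Γ ++ A ∷ A ∷ []) ∷ []) (Γ ++ [ A ])

Mp Pp Np GS1p : Rule
Mp   = Ax ∪ Mix ∪ Oplus ∪ Par
Pp   = Ax ∪ Tensor ∪ Oplus ∪ Contr
Np   = Ax ∪ With ∪ Par ∪ Weak
GS1p = Ax ∪ With ∪ Oplus ∪ Weak ∪ Contr

data Deriv (S : Rule) (H : Seq → Set) : Seq → Set where
  leaf : ∀ {Γ} → H Γ → Deriv S H Γ
  rule : ∀ {ps c} → S ps c → All (Deriv S H) ps → Deriv S H c
  exch : ∀ {Γ Δ} → Γ ↭ Δ → Deriv S H Γ → Deriv S H Δ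

DerivableIn : Rule → Rule → Set
DerivableIn R S = ∀ ps c → R ps c → Deriv S (λ Γ → Γ ∈ ps) c

Contains : Rule → Rule → Set
Contains S T = DerivableIn T S

-- The context-sharing (∧) comes in Pp from (⊗), applied to the premises
-- Γ,Δ,A and Γ,Σ,B, followed by contracting the duplicated Γ; in Np and GS1p it
-- comes from (&) after weakening both premises to the common context Γ,Δ,Σ.
-- (par) comes from (⊕₁) then (⊕₂), which introduce A∨B twice, and a
-- contraction; conversely in Np (⊕ᵢ) is (par) after weakening by the missing
-- disjunct.

module Submission where

open import Defs
open import Data.Product using (_×_; _,_)
open import Data.Sum using (inj₁; inj₂)
open import Data.List using ([]; _∷_; [_]; _++_)
open import Data.List.Properties using (++-assoc; ++-identityʳ)
open import Data.List.Relation.Unary.All using ([]; _∷_; tabulate)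
open import Data.List.Relation.Unary.Any using (here; there)
open import Data.List.Membership.Propositional using (_∈_)
open import Data.List.Relation.Binary.Permutation.Propositional
  using (↭-refl; ↭-sym; ↭-prep; ↭-swap; ↭-reflexive)
open import Data.List.Relation.Binary.Permutation.Propositional.Properties
  using (shift; ∷↭∷ʳ; ++⁺ˡ; ++-comm; ++-commutativeMonoid)
open import Algebra.Solver.CommutativeMonoid (++-commutativeMonoid {A = Formula})
  using (solve; _⊜_; _⊕_)
open import Function using (_∘_)
open import Relation.Binary.PropositionalEquality using (refl; sym)

_⊆_ : Rule → Rule → Set
R ⊆ S = ∀ {ps c} → R ps c → S ps c

⊆⇒derivable : ∀ {R S} → R ⊆ S → DerivableIn R S
⊆⇒derivable R⊆S ps c r = rule (R⊆S r) (tabulate leaf)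

∪-derivable : ∀ {R R′ S} → DerivableIn R S → DerivableIn R′ S → DerivableIn (R ∪ R′) S
∪-derivable R⊢S R′⊢S ps c (inj₁ r) = R⊢S ps c r
∪-derivable R⊢S R′⊢S ps c (inj₂ r) = R′⊢S ps c r

premise₁ : ∀ {S p ps} → Deriv S (_∈ p ∷ ps) p
premise₁ = leaf (here refl)

premise₂ : ∀ {S p q ps} → Deriv S (_∈ p ∷ q ∷ ps) q
premise₂ = leaf (there (here refl))

module _ {S : Rule} {H : Seq → Set} where

  contract : Contr ⊆ S → ∀ Γ A → Deriv S H (A ∷ A ∷ Γ) → Deriv S H (A ∷ Γ)
  contract C Γ A d =
    exch (↭-sym (∷↭∷ʳ A Γ)) (rule (C (contr Γ A)) (exch (++-comm (A ∷ A ∷ []) Γ) d ∷ []))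

  contract-all : Contr ⊆ S → ∀ Γ Δ → Deriv S H (Γ ++ Γ ++ Δ) → Deriv S H (Γ ++ Δ)
  contract-all C []      Δ d = d
  contract-all C (A ∷ Γ) Δ d =
    exch (shift A Γ Δ) (contract-all C Γ (A ∷ Δ)
      (exch (solve 3 (λ A Γ Δ → A ⊕ Γ ⊕ Γ ⊕ Δ ⊜ Γ ⊕ Γ ⊕ A ⊕ Δ) ↭-refl [ A ] Γ Δ)
        (contract C (Γ ++ Γ ++ Δ) A (exch (↭-prep A (shift A Γ (Γ ++ Δ))) d))))

  weaken : Weak ⊆ S → ∀ Γ A B → Deriv S H (Γ ++ [ A ]) → Deriv S H (Γ ++ A ∷ B ∷ [])
  weaken W Γ A B d =
    exch (solve 3 (λ Γ A B → A ⊕ Γ ⊕ B ⊜ Γ ⊕ A ⊕ B) ↭-refl Γ [ A ] [ B ])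
      (rule (W (weak A Γ B)) (exch (↭-sym (∷↭∷ʳ A Γ)) d ∷ []))

  weaken-all : Weak ⊆ S → ∀ B Γ Σ → Deriv S H (B ∷ Γ) → Deriv S H (B ∷ Γ ++ Σ)
  weaken-all W B Γ []      d = exch (↭-reflexive (sym (++-identityʳ (B ∷ Γ)))) d
  weaken-all W B Γ (A ∷ Σ) d =
    exch (↭-reflexive (++-assoc (B ∷ Γ) [ A ] Σ))
      (weaken-all W B (Γ ++ [ A ]) Σ (rule (W (weak B Γ A)) (d ∷ [])))

  mix-by-tensor : Tensor ⊆ S → Contr ⊆ S → ∀ Γ Δ Σ A B →
    Deriv S H (Γ ++ Δ ++ [ A ]) → Deriv S H (Γ ++ Σ ++ [ B ]) → Deriv S H (Γ ++ Δ ++ Σ ++ [ A ∧ B ])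
  mix-by-tensor T C Γ Δ Σ A B d e =
    contract-all C Γ (Δ ++ Σ ++ [ A ∧ B ])
      (exch (solve 4 (λ Γ Δ Σ X → (Γ ⊕ Δ) ⊕ (Γ ⊕ Σ) ⊕ X ⊜ Γ ⊕ Γ ⊕ Δ ⊕ Σ ⊕ X) ↭-refl Γ Δ Σ [ A ∧ B ])
        (rule (T (tensor (Γ ++ Δ) (Γ ++ Σ) A B))
          (exch (↭-reflexive (sym (++-assoc Γ Δ [ A ]))) d
           ∷ exch (↭-reflexive (sym (++-assoc Γ Σ [ B ]))) e ∷ [])))

  mix-by-with : With ⊆ S → Weak ⊆ S → ∀ Γ Δ Σ A B →
    Deriv S H (Γ ++ Δ ++ [ A ]) → Deriv S H (Γ ++ Σ ++ [ B ]) → Deriv S H (Γ ++ Δ ++ Σ ++ [ A ∧ B ])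
  mix-by-with Wi W Γ Δ Σ A B d e =
    exch (solve 4 (λ Γ Δ Σ X → (Γ ⊕ Δ ⊕ Σ) ⊕ X ⊜ Γ ⊕ Δ ⊕ Σ ⊕ X) ↭-refl Γ Δ Σ [ A ∧ B ])
      (rule (Wi (with' (Γ ++ Δ ++ Σ) A B)) (weakened-left ∷ weakened-right ∷ []))
    where
    weakened-left : Deriv S H ((Γ ++ Δ ++ Σ) ++ [ A ])
    weakened-left =
      exch (solve 4 (λ Γ Δ Σ A → A ⊕ (Γ ⊕ Δ) ⊕ Σ ⊜ (Γ ⊕ Δ ⊕ Σ) ⊕ A) ↭-refl Γ Δ Σ [ A ])
        (weaken-all W A (Γ ++ Δ) Σ
          (exch (solve 3 (λ Γ Δ A → Γ ⊕ Δ ⊕ A ⊜ A ⊕ Γ ⊕ Δ) ↭-refl Γ Δ [ A ]) d))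
    weakened-right : Deriv S H ((Γ ++ Δ ++ Σ) ++ [ B ])
    weakened-right =
      exch (solve 4 (λ Γ Δ Σ B → B ⊕ (Γ ⊕ Σ) ⊕ Δ ⊜ (Γ ⊕ Δ ⊕ Σ) ⊕ B) ↭-refl Γ Δ Σ [ B ])
        (weaken-all W B (Γ ++ Σ) Δ
          (exch (solve 3 (λ Γ Σ B → Γ ⊕ Σ ⊕ B ⊜ B ⊕ Γ ⊕ Σ) ↭-refl Γ Σ [ B ]) e))

  par-by-oplus : Oplus ⊆ S → Contr ⊆ S → ∀ Γ A B →
    Deriv S H (Γ ++ A ∷ B ∷ []) → Deriv S H (Γ ++ [ A ∨ B ])
  par-by-oplus O C Γ A B d =
    rule (C (contr Γ (A ∨ B))) (exch (↭-reflexive (++-assoc Γ [ A ∨ B ] [ A ∨ B ])) A∨B-twice ∷ [])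
    where
    A-to-A∨B : Deriv S H ((Γ ++ [ B ]) ++ [ A ∨ B ])
    A-to-A∨B = rule (O (oplus₁ (Γ ++ [ B ]) A B))
      (exch (solve 3 (λ Γ A B → Γ ⊕ A ⊕ B ⊜ (Γ ⊕ B) ⊕ A) ↭-refl Γ [ A ] [ B ]) d ∷ [])
    A∨B-twice : Deriv S H ((Γ ++ [ A ∨ B ]) ++ [ A ∨ B ])
    A∨B-twice = rule (O (oplus₂ (Γ ++ [ A ∨ B ]) A B))
      (exch (solve 3 (λ Γ B X → (Γ ⊕ B) ⊕ X ⊜ (Γ ⊕ X) ⊕ B) ↭-refl Γ [ B ] [ A ∨ B ]) A-to-A∨B ∷ [])

mix-derivable-by-tensor : ∀ {S} → Tensor ⊆ S → Contr ⊆ S → DerivableIn Mix S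
mix-derivable-by-tensor T C _ _ (mix Γ Δ Σ A B) = mix-by-tensor T C Γ Δ Σ A B premise₁ premise₂

mix-derivable-by-with : ∀ {S} → With ⊆ S → Weak ⊆ S → DerivableIn Mix S
mix-derivable-by-with Wi W _ _ (mix Γ Δ Σ A B) = mix-by-with Wi W Γ Δ Σ A B premise₁ premise₂

par-derivable-by-oplus : ∀ {S} → Oplus ⊆ S → Contr ⊆ S → DerivableIn Par S
par-derivable-by-oplus O C _ _ (par Γ A B) = par-by-oplus O C Γ A B premise₁

oplus-derivable-by-par : ∀ {S} → Par ⊆ S → Weak ⊆ S → DerivableIn Oplus S
oplus-derivable-by-par P W _ _ (oplus₁ Γ A₁ A₂) =
  rule (P (par Γ A₁ A₂)) (weaken W Γ A₁ A₂ premise₁ ∷ [])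
oplus-derivable-by-par P W _ _ (oplus₂ Γ A₁ A₂) =
  rule (P (par Γ A₁ A₂)) (exch (++⁺ˡ Γ (↭-swap A₂ A₁ ↭-refl)) (weaken W Γ A₂ A₁ premise₁) ∷ [])

lemma11 : Contains Pp Mp × Contains Np Mp × Contains GS1p Mp
lemma11 = Pp⊇Mp , Np⊇Mp , GS1p⊇Mp
  where
  Pp⊇Mp : Contains Pp Mp
  Pp⊇Mp =
    ∪-derivable (⊆⇒derivable inj₁)
   (∪-derivable (mix-derivable-by-tensor (inj₂ ∘ inj₁) (inj₂ ∘ inj₂ ∘ inj₂))
   (∪-derivable (⊆⇒derivable (inj₂ ∘ inj₂ ∘ inj₁))
                (par-derivable-by-oplus (inj₂ ∘ inj₂ ∘ inj₁) (inj₂ ∘ inj₂ ∘ inj₂))))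

  Np⊇Mp : Contains Np Mp
  Np⊇Mp =
    ∪-derivable (⊆⇒derivable inj₁)
   (∪-derivable (mix-derivable-by-with (inj₂ ∘ inj₁) (inj₂ ∘ inj₂ ∘ inj₂))
   (∪-derivable (oplus-derivable-by-par (inj₂ ∘ inj₂ ∘ inj₁) (inj₂ ∘ inj₂ ∘ inj₂))
                (⊆⇒derivable (inj₂ ∘ inj₂ ∘ inj₁))))

  GS1p⊇Mp : Contains GS1p Mp
  GS1p⊇Mp =
    ∪-derivable (⊆⇒derivable inj₁)
   (∪-derivable (mix-derivable-by-with (inj₂ ∘ inj₁) (inj₂ ∘ inj₂ ∘ inj₂ ∘ inj₁))
   (∪-derivable (⊆⇒derivable (inj₂ ∘ inj₂ ∘ inj₁))
                (par-derivable-by-oplus (inj₂ ∘ inj₂ ∘ inj₁) (inj₂ ∘ inj₂ ∘ inj₂ ∘ inj₂))))
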